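{- Let $K$ be the Kirchhoff matrix of a quiver with $n \geq 2$ vertices. Then every principal submatrix of $K$ obtained by deleting some, but not all, of the rows together with the corresponding columns is the Kirchhoff matrix of a quiver.
   Context: A quiver $G=(V,E)$ consists of a finite vertex set $V=\{1,\dots,n\}$ and a finite list (multiset) of edges $E=\{(v_j,w_j)\in V\times V\}$, where repeated pairs and self-loops $(v,v)$ are allowed. The adjacency matrix $A$ has $A_{ij}$ ($i\neq j$) equal to the number of edges equal to $(i,j)$ or $(j,i)$ and $A_{ii}=0$. The degree of a vertex $v$ is the number of edges having $v$ as an endpoint, a self-loop at $v$ counting once; $B$ is the diagonal matrix of degrees and the Kirchhoff matrix is $K=B-A$. A matrix is "the Kirchhoff matrix of a quiver" if it equals $K$ for some quiver, up to labeling of the vertices by the retained indices. -}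

module Defs where

open import Data.Nat using (ℕ)
open import Data.Fin using (Fin; _≟_)
open import Data.Product using (_×_; _,_)
open import Data.Product.Properties using (≡-dec)
open import Data.Sum using (_⊎_)
open import Data.List using (List; length; filter)
open import Data.Bool using (if_then_else_)
open import Data.Integer using (ℤ; +_; _-_)
open import Relation.Nullary using (does)
open import Relation.Nullary.Decidable using (_⊎-dec_)
open import Relation.Binary.PropositionalEquality using (_≡_)

-- A quiver on the vertex set Fin n: a finite list (multiset) of edges,
-- repeated pairs and self-loops allowed.
record Quiver (n : ℕ) : Set where
  constructor quiver
  field
    edges : List (Fin n × Fin n)
open Quiver public

edge≟ : ∀ {n} (e f : Fin n × Fin n) → Relation.Nullary.Dec (e ≡ f)
edge≟ = ≡-dec _≟_ _≟_

adjacency : ∀ {n} → Quiver n → Fin n → Fin n → ℕ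
adjacency G i j =
  if does (i ≟ j) then 0
  else length (filter (λ e → edge≟ e (i , j) ⊎-dec edge≟ e (j , i)) (edges G))

-- Degree: number of edges having v as an endpoint (a self-loop counts once).
degree : ∀ {n} → Quiver n → Fin n → ℕ
degree G v = length (filter (λ { (a , b) → (a ≟ v) ⊎-dec (b ≟ v) }) (edges G))

degreeMatrix : ∀ {n} → Quiver n → Fin n → Fin n → ℕ
degreeMatrix G i j = if does (i ≟ j) then degree G i else 0

kirchhoff : ∀ {n} → Quiver n → Fin n → Fin n → ℤ
kirchhoff G i j = + degreeMatrix G i j - + adjacency G i j

-- Deleting a set of vertices and replacing every edge with exactly one deleted
-- endpoint by a self-loop at its retained endpoint gives a quiver on the retained
-- vertices. A self-loop contributes 1 to the degree of its vertex, as the old edge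
-- did, and nothing to the adjacency matrix, so both the degrees and the adjacencies
-- among retained vertices are unchanged, and hence so is the Kirchhoff matrix.
module Submission where

open import Defs
open import Level using (Level)
open import Data.Nat using (ℕ; _≤_; _<_; _+_)
open import Data.Fin using (Fin; _≟_)
open import Data.Fin using () renaming (_<_ to _<ᶠ_)
open import Data.Fin.Properties using (any?; <-cmp; <⇒≢)
open import Data.Product using (Σ; ∃; ∄; _×_; _,_)
open import Data.Product.Properties using (,-injectiveˡ; ,-injectiveʳ)
open import Data.Sum using (_⊎_; inj₁; inj₂; [_,_]′)
open import Data.Sum.Function.Propositional using (_⊎-⇔_)
open import Data.List using (List; []; _∷_; [_]; _++_; length; filter; concatMap)
open import Data.List.Properties using (length-++; filter-++; filter-reject)
open import Data.Empty using (⊥-elim)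
open import Data.Integer using (+_; _-_)
open import Function using (_∘_; id)
open import Function.Bundles using (_⇔_; mk⇔; Equivalence)
open import Function.Definitions using (Injective)
open import Function.Properties.Equivalence using () renaming (sym to ⇔-sym; trans to ⇔-trans)
open import Relation.Binary.Definitions using (tri<; tri≈; tri>)
open import Relation.Binary.PropositionalEquality using (_≡_; _≢_; refl; sym; trans; cong; cong₂; module ≡-Reasoning)
open import Relation.Nullary using (Dec; yes; no; ¬_; _⊎-dec_)
open import Relation.Unary using (Pred; Decidable)

private
  variable
    A B : Set
    ℓ ℓ′ : Level
    k : ℕ

length-filter-++ : {P : Pred A ℓ} (P? : Decidable P) (xs ys : List A) →
  length (filter P? (xs ++ ys)) ≡ length (filter P? xs) + length (filter P? ys)
length-filter-++ P? xs ys = trans (cong length (filter-++ P? xs ys)) (length-++ (filter P? xs))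

length-filter-[]-⇔ : {P : Pred A ℓ} {Q : Pred B ℓ′} {x : A} {y : B}
  (P? : Decidable P) (Q? : Decidable Q) → P x ⇔ Q y →
  length (filter P? [ x ]) ≡ length (filter Q? [ y ])
length-filter-[]-⇔ {x = x} {y = y} P? Q? P⇔Q with P? x | Q? y
... | yes _  | yes _  = refl
... | no _   | no _   = refl
... | yes p  | no ¬q  = ⊥-elim (¬q (Equivalence.to P⇔Q p))
... | no ¬p  | yes q  = ⊥-elim (¬p (Equivalence.from P⇔Q q))

length-filter-concatMap : {P : Pred A ℓ} {Q : Pred B ℓ′}
  (P? : Decidable P) (Q? : Decidable Q) (g : A → List B) →
  (∀ x → length (filter Q? (g x)) ≡ length (filter P? [ x ])) →
  ∀ xs → length (filter Q? (concatMap g xs)) ≡ length (filter P? xs)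
length-filter-concatMap P? Q? g count-g [] = refl
length-filter-concatMap P? Q? g count-g (x ∷ xs) = begin
  length (filter Q? (g x ++ concatMap g xs))
    ≡⟨ length-filter-++ Q? (g x) (concatMap g xs) ⟩
  length (filter Q? (g x)) + length (filter Q? (concatMap g xs))
    ≡⟨ cong₂ _+_ (count-g x) (length-filter-concatMap P? Q? g count-g xs) ⟩
  length (filter P? [ x ]) + length (filter P? xs)
    ≡⟨ length-filter-++ P? [ x ] xs ⟨
  length (filter P? (x ∷ xs)) ∎
  where open ≡-Reasoning

strictlyMonotone⇒injective : {m n : ℕ} (f : Fin m → Fin n) →
  (∀ i j → i <ᶠ j → f i <ᶠ f j) → Injective _≡_ _≡_ f
strictlyMonotone⇒injective f mono {i} {j} fi≡fj with <-cmp i j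
... | tri< i<j _ _ = ⊥-elim (<⇒≢ (mono i j i<j) fi≡fj)
... | tri≈ _ i≡j _ = i≡j
... | tri> _ _ j<i = ⊥-elim (<⇒≢ (mono j i j<i) (sym fi≡fj))

-- `degree G v` and, for i ≢ j, `adjacency G i j` are definitionally the numbers of edges
-- of G satisfying `incident? v` and `joins? i j`.
Incident : Fin k → Fin k × Fin k → Set
Incident v (a , b) = a ≡ v ⊎ b ≡ v

incident? : (v : Fin k) → Decidable (Incident v)
incident? v (a , b) = (a ≟ v) ⊎-dec (b ≟ v)

Joins : Fin k → Fin k → Fin k × Fin k → Set
Joins i j e = e ≡ (i , j) ⊎ e ≡ (j , i)

joins? : (i j : Fin k) → Decidable (Joins i j)
joins? i j e = edge≟ e (i , j) ⊎-dec edge≟ e (j , i)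

edgeCount : List (Fin k × Fin k) → Fin k → Fin k → ℕ
edgeCount es i j = length (filter (joins? i j) es)

degree-[]-⇔ : {l : ℕ} {v : Fin k} {w : Fin l} {e : Fin k × Fin k} {e′ : Fin l × Fin l} →
  Incident v e ⇔ Incident w e′ → degree (quiver [ e ]) v ≡ degree (quiver [ e′ ]) w
degree-[]-⇔ = length-filter-[]-⇔ (incident? _) (incident? _)

degree-[]-reject : {v : Fin k} {e : Fin k × Fin k} → ¬ Incident v e → degree (quiver [ e ]) v ≡ 0
degree-[]-reject = cong length ∘ filter-reject (incident? _)

edgeCount-[]-⇔ : {l : ℕ} {i j : Fin k} {i′ j′ : Fin l} {e : Fin k × Fin k} {e′ : Fin l × Fin l} →
  Joins i j e ⇔ Joins i′ j′ e′ → edgeCount [ e ] i j ≡ edgeCount [ e′ ] i′ j′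
edgeCount-[]-⇔ = length-filter-[]-⇔ (joins? _ _) (joins? _ _)

edgeCount-[]-reject : {i j : Fin k} {e : Fin k × Fin k} → ¬ Joins i j e → edgeCount [ e ] i j ≡ 0
edgeCount-[]-reject = cong length ∘ filter-reject (joins? _ _)

incident-loop : {c v : Fin k} → Incident v (c , c) ⇔ c ≡ v
incident-loop = mk⇔ [ id , id ]′ inj₁

incident-onlyˡ : {a b v : Fin k} → b ≢ v → Incident v (a , b) ⇔ a ≡ v
incident-onlyˡ b≢v = mk⇔ [ id , ⊥-elim ∘ b≢v ]′ inj₁

incident-onlyʳ : {a b v : Fin k} → a ≢ v → Incident v (a , b) ⇔ b ≡ v
incident-onlyʳ a≢v = mk⇔ [ ⊥-elim ∘ a≢v , id ]′ inj₂

loop-¬joins : {c i j : Fin k} → i ≢ j → ¬ Joins i j (c , c)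
loop-¬joins i≢j (inj₁ refl) = i≢j refl
loop-¬joins i≢j (inj₂ refl) = i≢j refl

module Restriction {m n : ℕ} (f : Fin m → Fin n) (f-injective : Injective _≡_ _≡_ f) where

  Outside : Fin n → Set
  Outside a = ∄ λ c → f c ≡ a

  preimage : (a : Fin n) → Dec (∃ λ c → f c ≡ a)
  preimage a = any? (λ c → f c ≟ a)

  outside⇒≢ : {a : Fin n} → Outside a → ∀ i → a ≢ f i
  outside⇒≢ a∉ i a≡fi = a∉ (i , sym a≡fi)

  outsideˡ-¬joins : {a b : Fin n} → Outside a → ∀ i j → ¬ Joins (f i) (f j) (a , b)
  outsideˡ-¬joins a∉ i j (inj₁ refl) = a∉ (i , refl)
  outsideˡ-¬joins a∉ i j (inj₂ refl) = a∉ (j , refl)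

  outsideʳ-¬joins : {a b : Fin n} → Outside b → ∀ i j → ¬ Joins (f i) (f j) (a , b)
  outsideʳ-¬joins b∉ i j (inj₁ refl) = b∉ (j , refl)
  outsideʳ-¬joins b∉ i j (inj₂ refl) = b∉ (i , refl)

  ≡⇔f≡ : {c i : Fin m} → c ≡ i ⇔ f c ≡ f i
  ≡⇔f≡ = mk⇔ (cong f) f-injective

  ≡⇔f×f≡ : {c d i j : Fin m} → (c , d) ≡ (i , j) ⇔ (f c , f d) ≡ (f i , f j)
  ≡⇔f×f≡ = mk⇔ (cong (λ { (x , y) → f x , f y }))
    (λ eq → cong₂ _,_ (f-injective (,-injectiveˡ eq)) (f-injective (,-injectiveʳ eq)))

  restrictEdge : Fin n × Fin n → List (Fin m × Fin m)
  restrictEdge (a , b) with preimage a | preimage b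
  ... | yes (c , _) | yes (d , _) = [ (c , d) ]
  ... | yes (c , _) | no _        = [ (c , c) ]
  ... | no _        | yes (d , _) = [ (d , d) ]
  ... | no _        | no _        = []

  restrict : Quiver n → Quiver m
  restrict G = quiver (concatMap restrictEdge (edges G))

  degree-restrictEdge : ∀ e i → degree (quiver (restrictEdge e)) i ≡ degree (quiver [ e ]) (f i)
  degree-restrictEdge (a , b) i with preimage a | preimage b
  ... | yes (c , refl) | yes (d , refl) = degree-[]-⇔ (≡⇔f≡ ⊎-⇔ ≡⇔f≡)
  ... | yes (c , refl) | no b∉ =
    degree-[]-⇔ (⇔-trans incident-loop (⇔-trans ≡⇔f≡ (⇔-sym (incident-onlyˡ (outside⇒≢ b∉ i)))))
  ... | no a∉ | yes (d , refl) =
    degree-[]-⇔ (⇔-trans incident-loop (⇔-trans ≡⇔f≡ (⇔-sym (incident-onlyʳ (outside⇒≢ a∉ i)))))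
  ... | no a∉ | no b∉ =
    sym (degree-[]-reject [ outside⇒≢ a∉ i , outside⇒≢ b∉ i ]′)

  edgeCount-restrictEdge : ∀ e i j → i ≢ j →
    edgeCount (restrictEdge e) i j ≡ edgeCount [ e ] (f i) (f j)
  edgeCount-restrictEdge (a , b) i j i≢j with preimage a | preimage b
  ... | yes (c , refl) | yes (d , refl) = edgeCount-[]-⇔ (≡⇔f×f≡ ⊎-⇔ ≡⇔f×f≡)
  ... | yes (c , refl) | no b∉ =
    trans (edgeCount-[]-reject (loop-¬joins {c = c} i≢j))
          (sym (edgeCount-[]-reject (outsideʳ-¬joins {a = f c} b∉ i j)))
  ... | no a∉ | yes (d , refl) =
    trans (edgeCount-[]-reject (loop-¬joins {c = d} i≢j))
          (sym (edgeCount-[]-reject (outsideˡ-¬joins {b = f d} a∉ i j)))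
  ... | no a∉ | no b∉ =
    sym (edgeCount-[]-reject (outsideˡ-¬joins a∉ i j))

  degree-restrict : ∀ G i → degree (restrict G) i ≡ degree G (f i)
  degree-restrict G i =
    length-filter-concatMap _ _ restrictEdge (λ e → degree-restrictEdge e i) (edges G)

  edgeCount-restrict : ∀ G i j → i ≢ j →
    edgeCount (edges (restrict G)) i j ≡ edgeCount (edges G) (f i) (f j)
  edgeCount-restrict G i j i≢j =
    length-filter-concatMap _ _ restrictEdge (λ e → edgeCount-restrictEdge e i j i≢j) (edges G)

  degreeMatrix-restrict : ∀ G i j → degreeMatrix (restrict G) i j ≡ degreeMatrix G (f i) (f j)
  degreeMatrix-restrict G i j with i ≟ j | f i ≟ f j
  ... | yes _   | yes _     = degree-restrict G i
  ... | no _    | no _      = refl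
  ... | yes i≡j | no fi≢fj  = ⊥-elim (fi≢fj (cong f i≡j))
  ... | no i≢j  | yes fi≡fj = ⊥-elim (i≢j (f-injective fi≡fj))

  adjacency-restrict : ∀ G i j → adjacency (restrict G) i j ≡ adjacency G (f i) (f j)
  adjacency-restrict G i j with i ≟ j | f i ≟ f j
  ... | yes _   | yes _     = refl
  ... | no i≢j  | no _      = edgeCount-restrict G i j i≢j
  ... | yes i≡j | no fi≢fj  = ⊥-elim (fi≢fj (cong f i≡j))
  ... | no i≢j  | yes fi≡fj = ⊥-elim (i≢j (f-injective fi≡fj))

  kirchhoff-restrict : ∀ G i j → kirchhoff (restrict G) i j ≡ kirchhoff G (f i) (f j)
  kirchhoff-restrict G i j =
    cong₂ (λ d a → + d - + a) (degreeMatrix-restrict G i j) (adjacency-restrict G i j)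

lemma3 : (n : ℕ) → 2 ≤ n → (G : Quiver n) →
    (m : ℕ) → 1 ≤ m → m < n →
    (f : Fin m → Fin n) → (∀ i j → i <ᶠ j → f i <ᶠ f j) →
    Σ (Quiver m) (λ H → ∀ i j → kirchhoff H i j ≡ kirchhoff G (f i) (f j))
lemma3 n _ G m _ _ f mono = restrict G , kirchhoff-restrict G
  where open Restriction f (strictlyMonotone⇒injective f mono)
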